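{- Let $N\ge3$ and $G\in\mathcal G_3(N)$. Let $s=(x^1,\dots,x^{N-1},u,N)$ be a noncapture state with the robber at $u$ to move such that $c(G|s)=1$ and, writing $\widehat C(s)=C_m$, for every strategy profile $\sigma^{ -m}$ of the other tokens, $(s,\widehat\sigma^m,\sigma^{ -m})$ leads to $C_m$ capture. Then: (1) $|N(u)|=1$, i.e., $u$ is a leaf; and (2) if $N(u)=\{v\}$, then $c(G|s')=\infty$ for every noncapture state $s'=(y^1,\dots,y^{N-1},v,N)$ with the robber at $v$ to move.
   Context: Graphs are finite, undirected, connected and simple; $N(u)$ is the open neighbourhood of $u$; $c(G)$ is the classical cop number. There are $N$ tokens: cops $C_1,\dots,C_{N-1}$ (tokens $1,\dots,N-1$) and a robber $R$ (token $N$). A state is $s=(x^1,\dots,x^N,n)$, $x^i\in V$ the location of token $i$, $n$ the token moving next; $S^n$ is the set of states where token $n$ moves. $s$ is a capture state if $x^i=x^N$ for some $i\le N-1$, otherwise a noncapture state; $S_{nc}$ is the set of noncapture states. In each turn only the token to move moves, to a vertex of its closed neighbourhood (it may stay put), turns cycling $C_1,\dots,C_{N-1},R,C_1,\dots$; time counts single moves; play stops at capture. In the modified cops and robber game (two-player zero-sum, the robber's controller gets $-\gamma^t$ if capture occurs at time $t$ and $0$ otherwise, $\gamma\in(0,1)$, the other player controlling all cops), $\widehat\Sigma^n$ is the set of token-$n$ components of optimal pure positional strategies (CR-optimal strategies); $\widehat\sigma^m$ denotes an element of $\widehat\Sigma^m$. For every $s\in S_{nc}$ from which play under CR-optimal profiles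 leads to capture, the capture is always effected by the same cop, denoted $\widehat C(s)$. "$(s,\sigma)$ leads to $C_m$ capture" means play from $s$ under profile $\sigma$ reaches a capture state with $C_m$ on the robber's vertex. State cop number: for $s\in S_{nc}$, $c(G|s)$ is the least $k\in\{1,\dots,N-1\}$ such that some $k$ of the cops have strategies which, starting from $s$, lead to capture (by any cop) against all strategies of the remaining $N-k$ tokens; $c(G|s)=\infty$ if none. Graph classes: $\mathcal G(N)=\{G: c(G)>N-1\}$; $\mathcal G_1(N)=\{G\in\mathcal G(N):\exists s\in S_{nc},\ c(G|s)\in\{2,\dots,N-1\}\}$; $\mathcal G_1'(N)=\mathcal G(N)\setminus\mathcal G_1(N)$; $\mathcal G_2(N)=\{G\in\mathcal G(N):\forall s\in S^N\cap S_{nc},\ c(G|s)=\infty\}$; $\mathcal G_2'(N)=\mathcal G_1'(N)\setminus\mathcal G_2(N)$; $\mathcal G_3(N)$ is the set of $G\in\mathcal G_2'(N)$ such that for every $s\in S_{nc}$ with $c(G|s)=1$, writing $\widehat C(s)=C_m$, and for every strategy profile $\sigma^{ -m}$ of the other $N-1$ tokens, $(s,\widehat\sigma^m,\sigma^{ -m})$ leads to $C_m$ capture. -}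

module Defs where

open import Data.Nat using (ℕ; zero; suc; _≤_; _<_)
open import Data.Bool using (Bool; true; false; if_then_else_)
open import Data.Fin using (Fin; zero; suc; toℕ; fromℕ; inject₁; lower₁)
open import Data.Fin.Properties using (any?) renaming (_≟_ to _≟F_)
open import Data.Fin.Subset using (Subset; ∣_∣)
open import Data.Vec using (Vec; lookup; tabulate)
open import Data.Product using (Σ; ∃; _×_; _,_; proj₁; proj₂)
open import Data.Sum using (_⊎_)
open import Relation.Nullary using (¬_; Dec; yes; no)
open import Relation.Binary.PropositionalEquality using (_≡_; _≢_; refl; sym)
import Data.Nat as ℕ
open import Data.Nat.Properties using (suc-injective)

data Walk {n : ℕ} (E : Fin n → Fin n → Bool) : Fin n → Fin n → Set where
  here : ∀ {u} → Walk E u u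
  step : ∀ {u w v} → E u w ≡ true → Walk E w v → Walk E u v

record Graph : Set where
  field
    n         : ℕ
    E         : Fin n → Fin n → Bool
    E-sym     : ∀ u v → E u v ≡ E v u
    E-irrefl  : ∀ u → E u u ≡ false
    connected : ∀ u v → Walk E u v

module _ (G : Graph) where
  open Graph G

  V : Set
  V = Fin n

  Nbhd : V → Subset n
  Nbhd u = tabulate (E u)

  Legal : V → V → Set
  Legal x y = (y ≡ x) ⊎ (E x y ≡ true)

module Classical (G : Graph) (k : ℕ) where
  open Graph G

  Captured : (Fin k → Fin n) → Fin n → Set
  Captured c r = ∃ λ (i : Fin k) → c i ≡ r

  captured? : ∀ c r → Dec (Captured c r)
  captured? c r = any? (λ i → c i ≟F r)

  CopStrat : Set
  CopStrat = Σ ((Fin k → Fin n) → Fin n → (Fin k → Fin n))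
               (λ f → ∀ c r i → Legal G (c i) (f c r i))

  RobStrat : Set
  RobStrat = Σ ((Fin k → Fin n) → Fin n → Fin n)
               (λ g → ∀ c r → Legal G r (g c r))

  record Conf : Set where
    constructor conf
    field
      cpos : Fin k → Fin n
      rpos : Fin n
      copsMove : Bool

  hstep : CopStrat → RobStrat → Conf → Conf
  hstep f g (conf c r b) with captured? c r
  ... | yes _ = conf c r b
  ... | no _ = if b then conf (proj₁ f c r) r false else conf c (proj₁ g c r) true

  crun : CopStrat → RobStrat → Conf → ℕ → Conf
  crun f g x zero = x
  crun f g x (suc t) = hstep f g (crun f g x t)

  CopWin : Set
  CopWin = Σ (Fin k → Fin n) λ c₀ → Σ CopStrat λ f →
             ∀ (r₀ : Fin n) (g : RobStrat) → ∃ λ t →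
               Captured (Conf.cpos (crun f g (conf c₀ r₀ true) t))
                        (Conf.rpos (crun f g (conf c₀ r₀ true) t))

CopNumberGt : Graph → ℕ → Set
CopNumberGt G K = ∀ k → k ≤ K → ¬ Classical.CopWin G k

-- The N-token game, N = suc K: cops C₁..C_K are tokens inject₁ c (c : Fin K),
-- the robber is token fromℕ K.

module Game (G : Graph) (K : ℕ) where
  open Graph G

  Tok : Set
  Tok = Fin (suc K)

  robber : Tok
  robber = fromℕ K

  cop : Fin K → Tok
  cop = inject₁

  -- turn order C₁,…,C_K,R,C₁,…
  nextTok : Tok → Tok
  nextTok i with toℕ i ℕ.≟ K
  ... | yes _ = zero
  ... | no p = lower₁ (suc i) (λ e → p (sym (suc-injective e)))

  record State : Set where
    constructor st
    field
      pos   : Tok → V G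
      mover : Tok
  open State public

  IsCapture : State → Set
  IsCapture s = ∃ λ (c : Fin K) → pos s (cop c) ≡ pos s robber

  NonCapture : State → Set
  NonCapture s = ¬ IsCapture s

  capture? : ∀ s → Dec (IsCapture s)
  capture? s = any? (λ c → pos s (cop c) ≟F pos s robber)

  Strategy : Tok → Set
  Strategy i = Σ (State → V G) λ f → ∀ s → Legal G (pos s i) (f s)

  Profile : Set
  Profile = (i : Tok) → Strategy i

  update : (Tok → V G) → Tok → V G → (Tok → V G)
  update p i v j with j ≟F i
  ... | yes _ = v
  ... | no _ = p j

  stepS : Profile → State → State
  stepS σ s with capture? s
  ... | yes _ = s
  ... | no _ = st (update (pos s) (mover s) (proj₁ (σ (mover s)) s)) (nextTok (mover s))

  run : Profile → State → ℕ → State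
  run σ s zero = s
  run σ s (suc t) = stepS σ (run σ s t)

  LeadsToCapture : Profile → State → Set
  LeadsToCapture σ s = ∃ λ t → IsCapture (run σ s t)

  LeadsToCopCapture : Profile → State → Fin K → Set
  LeadsToCopCapture σ s m = ∃ λ t → pos (run σ s t) (cop m) ≡ pos (run σ s t) robber

  override : Profile → (i : Tok) → Strategy i → Profile
  override σ i τ j with j ≟F i
  ... | yes refl = τ
  ... | no _ = σ j

  merge : Subset (suc K) → Profile → Profile → Profile
  merge A σ τ j = if lookup A j then σ j else τ j

  CanCaptureWith : ℕ → State → Set
  CanCaptureWith k s =
    Σ (Subset (suc K)) λ A → ∣ A ∣ ≡ k × lookup A robber ≡ false ×
      Σ Profile λ σ → ∀ (τ : Profile) → LeadsToCapture (merge A σ τ) s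

  StateCopNumIs : State → ℕ → Set
  StateCopNumIs s k = 1 ≤ k × k ≤ K × CanCaptureWith k s ×
                      (∀ j → 1 ≤ j → j < k → ¬ CanCaptureWith j s)

  StateCopNumInf : State → Set
  StateCopNumInf s = ∀ k → 1 ≤ k → k ≤ K → ¬ CanCaptureWith k s

  -- For any γ ∈ (0,1) the robber's payoff
  -- −γ^t (0 if no capture) is strictly increasing in the capture time
  -- t ∈ ℕ ∪ {∞}; so we compare profiles by capture time.

  CaptureTime≤ : Profile → Profile → State → Set
  CaptureTime≤ σ τ s = ∀ t → IsCapture (run τ s t) → IsCapture (run σ s t)

  CROptimal : Profile → Set
  CROptimal σ = ∀ (s : State) →
    (∀ (τ : Profile) → CaptureTime≤ σ (override τ robber (σ robber)) s) ×
    (∀ (ρ : Strategy robber) → CaptureTime≤ (override σ robber ρ) σ s)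

  InΣ̂ : (i : Tok) → Strategy i → Set
  InΣ̂ i f = Σ Profile λ σ → CROptimal σ ×
              (∀ s → mover s ≡ i → proj₁ (σ i) s ≡ proj₁ f s)

  ĈIs : State → Fin K → Set
  ĈIs s m = Σ Profile λ σ → CROptimal σ × LeadsToCopCapture σ s m

  ForcedĈCapture : State → Set
  ForcedĈCapture s = ∀ m → ĈIs s m → ∀ (f : Strategy (cop m)) → InΣ̂ (cop m) f →
                     ∀ (σ : Profile) → LeadsToCopCapture (override σ (cop m) f) s m

  InG : Set
  InG = CopNumberGt G K

  G1Cond : Set
  G1Cond = Σ State λ s → NonCapture s × ∃ λ k → 2 ≤ k × k ≤ K × StateCopNumIs s k

  InG1 : Set
  InG1 = InG × G1Cond

  InG1' : Set
  InG1' = InG × ¬ G1Cond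

  InG2 : Set
  InG2 = InG × (∀ s → mover s ≡ robber → NonCapture s → StateCopNumInf s)

  InG2' : Set
  InG2' = InG1' × ¬ InG2

  InG3 : Set
  InG3 = InG2' × (∀ s → NonCapture s → StateCopNumIs s 1 → ForcedĈCapture s)

{-# OPTIONS --safe #-}
-- Cops and robber is a finite reachability game, solved by attractor levels: the cops
-- always move one level down and the robber never loses more than one level, and this
-- profile is CR-optimal.  The same construction applied to a single cop C_m playing
-- against the robber and all other cops shows that a cop who forces the capture to be
-- his own can capture alone, while a cop who can capture alone gives c(G|s) = 1.
-- Such a forcing cop stands on every cop-occupied neighbour w of the robber, for
-- otherwise the robber steps onto w and is caught by someone else.  If the robber at u
-- had neighbours w ≠ w′, crowd the other cops on the neighbour w not held by the lone
-- winner: the forcing cop of that state is on w and wins alone, so crowding the others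
-- on w′ instead, the forcing cop of the new state must stand on both w and w′.  Hence
-- u is a leaf, and at its neighbour v the state cop number is neither 1 (v would be a
-- leaf too and G a single edge, won by one cop) nor in {2,…,N−1} (G ∉ G₁).
-- Winning positions are decidable only classically; since every conclusion is negative
-- or decidable, the strategies are built under a double negation.
module Submission where

open import Defs
open import Data.Nat using (ℕ; _≤_)
open import Data.Product using (_×_)
open import Data.Fin.Subset using (∣_∣; ⁅_⁆)
open import Relation.Binary.PropositionalEquality using (_≡_)

open import Data.Bool using (true; false; if_then_else_)
import Data.Bool as Bool
open import Data.Bool.Properties using (¬-not)
open import Data.Empty using (⊥; ⊥-elim)
open import Data.Fin using (Fin; zero; suc)
open import Data.Fin.Properties
  using (_≟_; any?; all?; ¬∀⟶∃¬; ∀-cons; fromℕ≢inject₁; inject₁-injective; toℕ<n)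
open import Data.Fin.Subset using (_∈_)
open import Data.Fin.Subset.Properties using (x∈⁅x⁆; x∈⁅y⁆⇒x≡y; x≢y⇒x∉⁅y⁆; ∣⁅x⁆∣≡1; ⊆-antisym)
open import Data.Nat using (zero; suc; pred; _∸_; _⊔_; _<_; _≤′_; ≤′-refl; ≤′-step; z≤n; s≤s; _≤?_)
open import Data.Nat.Properties
  using (≤-refl; ≤-trans; m≤m⊔n; m≤n⊔m; ≮⇒≥; ≰⇒>; ≤⇒≤′; pred-mono-≤; ∸-monoˡ-≤)
open import Data.Product using (Σ; ∃; _,_; proj₁; proj₂)
open import Data.Sum using (_⊎_; inj₁; inj₂; map₁; map₂)
open import Data.Unit using (⊤; tt)
open import Data.Vec using (lookup)
open import Data.Vec.Functional using (_∷_; head; tail)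
open import Data.Vec.Properties using ([]=⇒lookup; lookup⇒[]=; lookup∘tabulate)
open import Function using (_∘_; case_of_)
open import Relation.Binary.PropositionalEquality using (_≗_; _≢_; refl; sym; trans; cong; subst)
open import Relation.Nullary using (¬_; Dec; yes; no)
open import Relation.Nullary.Decidable
  using (_×-dec_; _⊎-dec_; _→-dec_; ¬?; ¬¬-excluded-middle; map′; decidable-stable)
open import Relation.Nullary.Negation using (¬¬-map)
open import Relation.Unary using (Decidable)

¬¬-∀-Fin : ∀ {m} {P : Fin m → Set} → (∀ i → ¬ ¬ P i) → ¬ ¬ (∀ i → P i)
¬¬-∀-Fin {zero} h ¬all = ¬all λ ()
¬¬-∀-Fin {suc m} h ¬all = h zero λ p₀ → ¬¬-∀-Fin (h ∘ suc) λ p₊ → ¬all (∀-cons p₀ p₊)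

¬¬-∀-Vector : ∀ {a b} {R : (Fin a → Fin b) → Set} →
              (∀ {f g} → f ≗ g → R f → R g) → (∀ f → ¬ ¬ R f) → ¬ ¬ (∀ f → R f)
¬¬-∀-Vector {zero} resp h ¬all = h (λ ()) λ r → ¬all λ f → resp (λ ()) r
¬¬-∀-Vector {suc a} resp h ¬all =
  ¬¬-∀-Fin (λ c → ¬¬-∀-Vector (resp ∘ ∷-cong) (h ∘ (c ∷_)))
    λ r → ¬all λ f → resp head∷tail (r (head f) (tail f))
  where
  ∷-cong : ∀ {c} {f g : Fin a → _} → f ≗ g → (c ∷ f) ≗ (c ∷ g)
  ∷-cong e zero = refl
  ∷-cong e (suc i) = e i
  head∷tail : ∀ {f : Fin (suc a) → _} → (head f ∷ tail f) ≗ f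
  head∷tail zero = refl
  head∷tail (suc i) = refl

Minimal : (ℕ → Set) → ℕ → Set
Minimal P j = P j × (∀ {i} → i < j → ¬ P i)

minimal≤ : ∀ {P : ℕ → Set} {j k} → (∀ {i} → i < j → ¬ P i) → P k → j ≤ k
minimal≤ min p = ≮⇒≥ λ k<j → min k<j p

minimal-suc : ∀ {P : ℕ → Set} {j} → ¬ P zero → Minimal (P ∘ suc) j → Minimal P (suc j)
minimal-suc ¬p₀ (pj , min) = pj , λ { {zero} _ → ¬p₀ ; {suc i} (s≤s i<j) → min i<j }

least : ∀ {P : ℕ → Set} → Decidable P → ∀ {k} → P k → ∃ (Minimal P)
least P? p with P? zero
... | yes p₀ = zero , p₀ , λ ()
least P? {zero} p | no ¬p₀ = ⊥-elim (¬p₀ p)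
least P? {suc k} p | no ¬p₀ with least (P? ∘ suc) p
... | j , min = suc j , minimal-suc ¬p₀ min

¬¬-least : ∀ {P : ℕ → Set} {k} → P k → ¬ ¬ ∃ (Minimal P)
¬¬-least {k = zero} p ¬min = ¬min (zero , p , λ ())
¬¬-least {P} {suc k} p ¬min = ¬¬-excluded-middle λ
  { (yes p₀) → ¬min (zero , p₀ , λ ())
  ; (no ¬p₀) → ¬¬-least {P ∘ suc} {k} p λ (j , min) → ¬min (suc j , minimal-suc ¬p₀ min) }

bound-Fin : ∀ {m} {P : Fin m → ℕ → Set} → (∀ {i j k} → j ≤ k → P i j → P i k) →
            (∀ i → ∃ (P i)) → ∃ λ k → ∀ i → P i k
bound-Fin {zero} mono h = zero , λ ()
bound-Fin {suc m} mono h with h zero | bound-Fin (mono {i = suc _}) (h ∘ suc)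
... | k₀ , p₀ | k₊ , p₊ = k₀ ⊔ k₊ , ∀-cons (mono (m≤m⊔n k₀ k₊) p₀) (λ i → mono (m≤n⊔m k₀ k₊) (p₊ i))

data Player : Set where
  reacher avoider : Player

opponent : Player → Player
opponent reacher = avoider
opponent avoider = reacher

opponent-≢ : ∀ pl → opponent pl ≢ pl
opponent-≢ reacher ()
opponent-≢ avoider ()

module ReachabilityGame {Q : Set} {n : ℕ}
  (Target : Q → Set) (target? : Decidable Target)
  (owner : Q → Player)
  (Allowed : Q → Fin n → Set) (allowed? : ∀ q → Decidable (Allowed q))
  (next : Q → Fin n → Q)
  (idle : ∀ q → ∃ (Allowed q)) where

  Forces : Player → (Q → Set) → Q → Set
  Forces reacher P q = ∃ λ v → Allowed q v × P (next q v)
  Forces avoider P q = ∀ v → Allowed q v → P (next q v)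

  forces? : ∀ pl {P} → Decidable P → Decidable (Forces pl P)
  forces? reacher P? q = any? λ v → allowed? q v ×-dec P? (next q v)
  forces? avoider P? q = all? λ v → allowed? q v →-dec P? (next q v)

  Attr : ℕ → Q → Set
  Attr zero q = Target q
  Attr (suc k) q = Attr k q ⊎ Forces (owner q) (Attr k) q

  attr? : ∀ k → Decidable (Attr k)
  attr? zero = target?
  attr? (suc k) q = attr? k q ⊎-dec forces? (owner q) (attr? k) q

  attr-mono′ : ∀ {j k q} → j ≤′ k → Attr j q → Attr k q
  attr-mono′ ≤′-refl a = a
  attr-mono′ (≤′-step j≤k) a = inj₁ (attr-mono′ j≤k a)

  attr-mono : ∀ {j k q} → j ≤ k → Attr j q → Attr k q
  attr-mono = attr-mono′ ∘ ≤⇒≤′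

  Winning : Q → Set
  Winning q = ∃ λ k → Attr k q

  ¬forces-avoider⇒∃¬ : ∀ {q} {P : Q → Set} → Decidable P → ¬ Forces avoider P q →
                       ∃ λ v → Allowed q v × ¬ P (next q v)
  ¬forces-avoider⇒∃¬ {q} P? ¬f with ¬∀⟶∃¬ _ _ (λ v → allowed? q v →-dec P? (next q v)) ¬f
  ... | v , ¬p with allowed? q v
  ...   | yes al = v , al , λ p → ¬p λ _ → p
  ...   | no ¬al = ⊥-elim (¬p λ al → ⊥-elim (¬al al))

  attr-suc-avoider : ∀ {k q} → owner q ≡ avoider → ¬ Target q → Attr (suc k) q →
                     Forces avoider (Attr k) q
  attr-suc-avoider {k} {q} own ¬t (inj₂ f) = subst (λ pl → Forces pl (Attr k) q) own f
  attr-suc-avoider {zero} own ¬t (inj₁ t) = ⊥-elim (¬t t)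
  attr-suc-avoider {suc k} own ¬t (inj₁ a) v al = inj₁ (attr-suc-avoider {k} own ¬t a v al)

  minimal-attr⇒forces : ∀ {ℓ q} → ¬ Target q → Minimal (λ i → Attr i q) ℓ →
                        Forces (owner q) (Attr (pred ℓ)) q
  minimal-attr⇒forces {zero} ¬t (t , _) = ⊥-elim (¬t t)
  minimal-attr⇒forces {suc j} ¬t (inj₁ a , min) = ⊥-elim (min ≤-refl a)
  minimal-attr⇒forces {suc j} ¬t (inj₂ f , _) = f

  forces-avoider⇒winning : ∀ {q} → owner q ≡ avoider → Forces avoider Winning q → Winning q
  forces-avoider⇒winning {q} own w
    with bound-Fin (λ j≤k a al → attr-mono j≤k (a al)) (λ v → bound (allowed? q v))
    where
    bound : ∀ {v} → Dec (Allowed q v) → ∃ λ k → Allowed q v → Attr k (next q v)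
    bound (yes al) = proj₁ (w _ al) , λ _ → proj₂ (w _ al)
    bound (no ¬al) = zero , λ al → ⊥-elim (¬al al)
  ... | k , a = suc k , inj₂ (subst (λ pl → Forces pl (Attr k) q) (sym own) a)

  module Invariance
    (_≈_ : Q → Q → Set) (≈-sym : ∀ {q q′} → q ≈ q′ → q′ ≈ q)
    (target-resp : ∀ {q q′} → q ≈ q′ → Target q → Target q′)
    (owner-resp : ∀ {q q′} → q ≈ q′ → owner q ≡ owner q′)
    (simulate : ∀ {q q′ v′} → q ≈ q′ → Allowed q′ v′ → ∃ λ v → Allowed q v × next q v ≈ next q′ v′)
    where

    attr-resp : ∀ k {q q′} → q ≈ q′ → Attr k q → Attr k q′
    attr-resp zero e t = target-resp e t
    attr-resp (suc k) e (inj₁ a) = inj₁ (attr-resp k e a)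
    attr-resp (suc k) {q} {q′} e (inj₂ f) =
      inj₂ (subst (λ pl → Forces pl (Attr k) q′) (owner-resp e) (forces-resp (owner q) f))
      where
      forces-resp : ∀ pl → Forces pl (Attr k) q → Forces pl (Attr k) q′
      forces-resp reacher (v , al , a) with simulate (≈-sym e) al
      ... | v′ , al′ , e′ = v′ , al′ , attr-resp k (≈-sym e′) a
      forces-resp avoider f v′ al′ with simulate e al′
      ... | v , al , e′ = attr-resp k e′ (f v al)

    winning-resp : ∀ {q q′} → q ≈ q′ → Winning q → Winning q′
    winning-resp e (k , a) = k , attr-resp k e a

  choose : (q : Q) {P : Fin n → Set} → Decidable P → Fin n
  choose q P? with any? (λ v → allowed? q v ×-dec P? v)
  ... | yes (v , _) = v
  ... | no _ = proj₁ (idle q)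

  choose-allowed : ∀ q {P} (P? : Decidable P) → Allowed q (choose q P?)
  choose-allowed q P? with any? (λ v → allowed? q v ×-dec P? v)
  ... | yes (_ , al , _) = al
  ... | no _ = proj₂ (idle q)

  choose-spec : ∀ q {P} (P? : Decidable P) → (∃ λ v → Allowed q v × P v) → P (choose q P?)
  choose-spec q P? e with any? (λ v → allowed? q v ×-dec P? v)
  ... | yes (_ , _ , p) = p
  ... | no ¬e = ⊥-elim (¬e e)

  module Optimal (winning? : Decidable Winning) where

    -- junk 0 on losing positions
    level : Q → ℕ
    level q with winning? q
    ... | yes (k , a) = proj₁ (least (λ i → attr? i q) {k} a)
    ... | no _ = zero

    level-minimal : ∀ {q} → Winning q → Minimal (λ i → Attr i q) (level q)
    level-minimal {q} w with winning? q
    ... | yes (k , a) = proj₂ (least (λ i → attr? i q) {k} a)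
    ... | no ¬w = ⊥-elim (¬w w)

    level-≤ : ∀ {k q} → Attr k q → level q ≤ k
    level-≤ {k} a = minimal≤ (proj₂ (level-minimal (k , a))) a

    -- from level ℓ, a move outside Attr (ℓ ∸ 2) loses at most one level
    avoiderMove : (q : Q) → Dec (Winning q) → Fin n
    avoiderMove q (yes _) = choose q (λ v → ¬? (attr? (level q ∸ 2) (next q v)))
    avoiderMove q (no _) = choose q (λ v → ¬? (winning? (next q v)))

    bestMove : Player → Q → Fin n
    bestMove reacher q = choose q (λ v → attr? (pred (level q)) (next q v))
    bestMove avoider q = avoiderMove q (winning? q)

    bestMove-allowed : ∀ pl q → Allowed q (bestMove pl q)
    bestMove-allowed reacher q = choose-allowed q _
    bestMove-allowed avoider q with winning? q
    ... | yes _ = choose-allowed q _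
    ... | no _ = choose-allowed q _

    reacher-descends : ∀ {k q} → owner q ≡ reacher → ¬ Target q → Attr (suc k) q →
                       Attr k (next q (bestMove reacher q))
    reacher-descends {k} {q} own ¬t a = attr-mono (pred-mono-≤ (level-≤ {suc k} a)) (choose-spec q _ entry)
      where
      entry : ∃ λ v → Allowed q v × Attr (pred (level q)) (next q v)
      entry = subst (λ pl → Forces pl (Attr (pred (level q))) q) own
                    (minimal-attr⇒forces ¬t (level-minimal (suc k , a)))

    avoider-ascends : ∀ {k q} → owner q ≡ avoider → Attr k (next q (bestMove avoider q)) → Attr (suc k) q
    avoider-ascends {k} {q} own a with winning? q
    ... | no ¬w =
      ⊥-elim (choose-spec q _ (¬forces-avoider⇒∃¬ winning? (¬w ∘ forces-avoider⇒winning own)) (k , a))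
    ... | yes w with level q ≤? suc k
    ...   | yes ℓ≤ = attr-mono ℓ≤ (proj₁ (level-minimal w))
    ...   | no ℓ≰ =
      ⊥-elim (choose-spec q _ (escape (level q) (≰⇒> ℓ≰) (level-minimal w))
                              (attr-mono (∸-monoˡ-≤ 2 (≰⇒> ℓ≰)) a))
      where
      escape : ∀ ℓ → suc k < ℓ → Minimal (λ i → Attr i q) ℓ → ∃ λ v → Allowed q v × ¬ Attr (ℓ ∸ 2) (next q v)
      escape (suc zero) (s≤s ()) _
      escape (suc (suc i)) _ (_ , min) = ¬forces-avoider⇒∃¬ (attr? i)
        λ f → min ≤-refl (inj₂ (subst (λ pl → Forces pl (Attr i) q) (sym own) f))

    play : Q → Fin n
    play q = bestMove (owner q) q

    play-allowed : ∀ q → Allowed q (play q)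
    play-allowed q = bestMove-allowed (owner q) q

    data Step (pl : Player) (p : ℕ → Q) (i : ℕ) : Set where
      step : ∀ v → Allowed (p i) v → p (suc i) ≡ next (p i) v →
             (owner (p i) ≡ pl → v ≡ bestMove pl (p i)) → Step pl p i

    step-shift : ∀ {pl p i} → Step pl p (suc i) → Step pl (p ∘ suc) i
    step-shift (step v al e guided) = step v al e guided

    step-descends : ∀ {k q v} → ¬ Target q → Attr (suc k) q → Allowed q v →
                    (owner q ≡ reacher → v ≡ bestMove reacher q) → Attr k (next q v)
    step-descends {k} {q} {v} ¬t a al guided = by (owner q) refl
      where
      by : ∀ pl → owner q ≡ pl → Attr k (next q v)
      by reacher own = subst (λ v → Attr k (next q v)) (sym (guided own)) (reacher-descends {k} own ¬t a)
      by avoider own = attr-suc-avoider {k} own ¬t a v al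

    reaches-within : (Goal : ℕ → Set) (p : ℕ → Q) → (∀ {i} → Target (p i) → Goal i) →
                     (∀ i → Goal i ⊎ Step reacher p i) → ∀ k → Attr k (p zero) → ∃ λ i → i ≤ k × Goal i
    reaches-within Goal p goal steps zero a = zero , z≤n , goal a
    reaches-within Goal p goal steps (suc k) a with target? (p zero) | steps zero
    ... | yes t | _ = zero , z≤n , goal t
    ... | no _ | inj₁ g = zero , z≤n , g
    ... | no ¬t | inj₂ (step v al e guided)
        with reaches-within (Goal ∘ suc) (p ∘ suc) goal (map₂ step-shift ∘ steps ∘ suc) k
               (subst (Attr k) (sym e) (step-descends {k} ¬t a al guided))
    ...   | i , i≤k , g = suc i , s≤s i≤k , g

    step-ascends : ∀ {p i j} → p (suc i) ≡ p i ⊎ Step avoider p i → Attr j (p (suc i)) → Attr (suc j) (p i)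
    step-ascends {j = j} (inj₁ e) a = inj₁ (subst (Attr j) e a)
    step-ascends {p} {i} {j} (inj₂ (step v al e guided)) a = by (owner (p i)) refl
      where
      a′ : Attr j (next (p i) v)
      a′ = subst (Attr j) e a
      by : ∀ pl → owner (p i) ≡ pl → Attr (suc j) (p i)
      by avoider own = avoider-ascends {j} own (subst (λ v → Attr j (next (p i) v)) (guided own) a′)
      by reacher own = inj₂ (subst (λ pl → Forces pl (Attr j) (p i)) (sym own) (v , al , a′))

    target-at⇒attr : ∀ {p} → (∀ i → p (suc i) ≡ p i ⊎ Step avoider p i) →
                     ∀ i → Target (p i) → Attr i (p zero)
    target-at⇒attr steps zero t = t
    target-at⇒attr {p} steps (suc i) t =
      step-ascends {p} {zero} {i} (steps zero) (target-at⇒attr (map₂ step-shift ∘ steps ∘ suc) i t)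

lookup-⁅⁆-self : ∀ {N} (i : Fin N) → lookup ⁅ i ⁆ i ≡ true
lookup-⁅⁆-self i = []=⇒lookup (x∈⁅x⁆ i)

lookup-⁅⁆-other : ∀ {N} {i j : Fin N} → j ≢ i → lookup ⁅ i ⁆ j ≡ false
lookup-⁅⁆-other j≢i = ¬-not (x≢y⇒x∉⁅y⁆ j≢i ∘ lookup⇒[]= _ _)

module GraphProperties (G : Graph) where
  open Graph G

  legal? : ∀ x → Decidable (Legal G x)
  legal? x v = (v ≟ x) ⊎-dec (E x v Bool.≟ true)

  adjacent-≢ : ∀ {y w} → E y w ≡ true → w ≢ y
  adjacent-≢ {y} adj refl with trans (sym adj) (E-irrefl y)
  ... | ()

  has-neighbour : ∀ {u v} → u ≢ v → ∃ λ w → E u w ≡ true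
  has-neighbour {u} {v} u≢v with connected u v
  ... | here = ⊥-elim (u≢v refl)
  ... | step adj _ = _ , adj

  ∈Nbhd⁺ : ∀ {y z} → E y z ≡ true → z ∈ Nbhd G y
  ∈Nbhd⁺ {y} {z} adj = lookup⇒[]= z _ (trans (lookup∘tabulate (E y) z) adj)

  ∈Nbhd⁻ : ∀ {y z} → z ∈ Nbhd G y → E y z ≡ true
  ∈Nbhd⁻ {y} {z} z∈N = trans (sym (lookup∘tabulate (E y) z)) ([]=⇒lookup z∈N)

  Nbhd≡⁅⁆ : ∀ {y w} → E y w ≡ true → (∀ {z} → E y z ≡ true → z ≡ w) → Nbhd G y ≡ ⁅ w ⁆
  Nbhd≡⁅⁆ {y} {w} adj unique =
    ⊆-antisym (λ z∈N → subst (_∈ ⁅ w ⁆) (sym (unique (∈Nbhd⁻ z∈N))) (x∈⁅x⁆ w))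
              (λ z∈w → subst (_∈ Nbhd G y) (sym (x∈⁅y⁆⇒x≡y w z∈w)) (∈Nbhd⁺ adj))

  Nbhd≡⁅⁆⁻ : ∀ {y v} → Nbhd G y ≡ ⁅ v ⁆ → E y v ≡ true × (∀ {z} → E y z ≡ true → z ≡ v)
  Nbhd≡⁅⁆⁻ {y} {v} N≡v =
    ∈Nbhd⁻ (subst (v ∈_) (sym N≡v) (x∈⁅x⁆ v)) ,
    λ adj → x∈⁅y⁆⇒x≡y v (subst (_ ∈_) N≡v (∈Nbhd⁺ adj))

  edge-copWin : ∀ {u v} → E u v ≡ true →
                (∀ {z} → E u z ≡ true → z ≡ v) → (∀ {z} → E v z ≡ true → z ≡ u) → Classical.CopWin G 1
  edge-copWin {u} {v} adj only-v only-u = (λ _ → v) , (chase , chase-legal) , catches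
    where
    open Classical G 1
    chase : (Fin 1 → V G) → V G → (Fin 1 → V G)
    chase c r i = if E (c i) r then r else c i
    chase-legal : ∀ c r i → Legal G (c i) (chase c r i)
    chase-legal c r i with E (c i) r in adj′
    ... | true = inj₂ adj′
    ... | false = inj₁ refl
    endpoints : ∀ {a b} → Walk E a b → a ≡ u ⊎ a ≡ v → b ≡ u ⊎ b ≡ v
    endpoints here at = at
    endpoints (step adj′ walk) (inj₁ refl) = endpoints walk (inj₂ (only-v adj′))
    endpoints (step adj′ walk) (inj₂ refl) = endpoints walk (inj₁ (only-u adj′))
    catches : ∀ r₀ (g : RobStrat) →
              ∃ λ t → Captured (Conf.cpos (crun (chase , chase-legal) g (conf (λ _ → v) r₀ true) t))
                               (Conf.rpos (crun (chase , chase-legal) g (conf (λ _ → v) r₀ true) t))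
    catches r₀ g with endpoints (connected u r₀) (inj₁ refl)
    ... | inj₂ refl = zero , zero , refl
    ... | inj₁ refl = 1 , caught
      where
      caught : Captured (Conf.cpos (hstep (chase , chase-legal) g (conf (λ _ → v) u true)))
                        (Conf.rpos (hstep (chase , chase-legal) g (conf (λ _ → v) u true)))
      caught with captured? (λ _ → v) u
      ... | yes c = c
      ... | no _ = zero , subst (λ b → (if b then u else v) ≡ u) (sym (trans (E-sym v u) adj)) refl

module GameProperties (G : Graph) (K : ℕ) where
  open Graph G
  open Game G K
  open GraphProperties G

  moveTo : State → V G → State
  moveTo t v = st (update (pos t) (mover t) v) (nextTok (mover t))

  moveOf : Profile → State → V G
  moveOf π t = proj₁ (π (mover t)) t

  update-self : ∀ p i v {j} → j ≡ i → update p i v j ≡ v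
  update-self p i v {j} j≡i with j ≟ i
  ... | yes _ = refl
  ... | no j≢i = ⊥-elim (j≢i j≡i)

  update-other : ∀ p i v {j} → j ≢ i → update p i v j ≡ p j
  update-other p i v {j} j≢i with j ≟ i
  ... | yes j≡i = ⊥-elim (j≢i j≡i)
  ... | no _ = refl

  update-idle : ∀ p i j → update p i (p i) j ≡ p j
  update-idle p i j with j ≟ i
  ... | yes refl = refl
  ... | no _ = refl

  stepS-capture : ∀ π {t} → IsCapture t → stepS π t ≡ t
  stepS-capture π {t} c with capture? t
  ... | yes _ = refl
  ... | no nc = ⊥-elim (nc c)

  stepS-move : ∀ π {t} → NonCapture t → stepS π t ≡ moveTo t (moveOf π t)
  stepS-move π {t} nc with capture? t
  ... | yes c = ⊥-elim (nc c)
  ... | no _ = refl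

  run-frozen : ∀ π s {i j} → i ≤ j → IsCapture (run π s i) → run π s j ≡ run π s i
  run-frozen π s {i} i≤j c = frozen (≤⇒≤′ i≤j)
    where
    frozen : ∀ {j} → i ≤′ j → run π s j ≡ run π s i
    frozen ≤′-refl = refl
    frozen (≤′-step i≤j) = trans (cong (stepS π) (frozen i≤j)) (stepS-capture π c)

  run-capture-mono : ∀ π s {i j} → i ≤ j → IsCapture (run π s i) → IsCapture (run π s j)
  run-capture-mono π s i≤j c = subst IsCapture (sym (run-frozen π s i≤j c)) c

  override-self : ∀ σ i f → override σ i f i ≡ f
  override-self σ i f with i ≟ i
  ... | yes refl = refl
  ... | no ¬refl = ⊥-elim (¬refl refl)

  override-other : ∀ σ i f {j} → j ≢ i → override σ i f j ≡ σ j
  override-other σ i f {j} j≢i with j ≟ i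
  ... | yes refl = ⊥-elim (j≢i refl)
  ... | no _ = refl

  moveOf-override-self : ∀ τ σ {i} t → mover t ≡ i → moveOf (override τ i (σ i)) t ≡ moveOf σ t
  moveOf-override-self τ σ t refl = cong (λ f → proj₁ f t) (override-self τ (mover t) (σ (mover t)))

  moveOf-override-other : ∀ σ {i} f t → mover t ≢ i → moveOf (override σ i f) t ≡ moveOf σ t
  moveOf-override-other σ f t ne = cong (λ g → proj₁ g t) (override-other σ _ f ne)

  moveOf-merge-inside : ∀ A σ τ t → lookup A (mover t) ≡ true → moveOf (merge A σ τ) t ≡ moveOf σ t
  moveOf-merge-inside A σ τ t inside rewrite inside = refl

  moveOf-merge-outside : ∀ A σ τ t → lookup A (mover t) ≡ false → moveOf (merge A σ τ) t ≡ moveOf τ t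
  moveOf-merge-outside A σ τ t outside rewrite outside = refl

  follow : (c : State → V G) → (∀ t → Legal G (pos t (mover t)) (c t)) → Profile
  follow c c-legal i = (λ t → move t (mover t ≟ i)) , (λ t → legal t (mover t ≟ i))
    where
    move : ∀ t → Dec (mover t ≡ i) → V G
    move t (yes _) = c t
    move t (no _) = pos t i
    legal : ∀ t d → Legal G (pos t i) (move t d)
    legal t (yes refl) = c-legal t
    legal t (no _) = inj₁ refl

  moveOf-follow : ∀ c c-legal t → moveOf (follow c c-legal) t ≡ c t
  moveOf-follow c c-legal t with mover t ≟ mover t
  ... | yes _ = refl
  ... | no ¬refl = ⊥-elim (¬refl refl)

  sole : Tok → Player → Tok → Player
  sole j pl i with i ≟ j
  ... | yes _ = pl
  ... | no _ = opponent pl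

  sole-self : ∀ {j pl} i → sole j pl i ≡ pl → i ≡ j
  sole-self {j} {pl} i e with i ≟ j
  ... | yes i≡j = i≡j
  ... | no _ = ⊥-elim (opponent-≢ pl e)

  sole-other : ∀ {j pl} i → sole j pl i ≡ opponent pl → i ≢ j
  sole-other {j} {pl} i e with i ≟ j
  ... | yes _ = ⊥-elim (opponent-≢ pl (sym e))
  ... | no i≢j = i≢j

  Agree : (Tok → Set) → State → State → Set
  Agree Tracked t t′ = mover t ≡ mover t′ × (∀ i → Tracked i → pos t i ≡ pos t′ i)

  agree-sym : ∀ {Tracked t t′} → Agree Tracked t t′ → Agree Tracked t′ t
  agree-sym (e , same) = sym e , λ i tr → sym (same i tr)

  -- a move of an untracked token is simulated by staying put
  agree-simulate : ∀ {Tracked} → Decidable Tracked → ∀ {t t′ v′} → Agree Tracked t t′ →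
                   Legal G (pos t′ (mover t′)) v′ →
                   ∃ λ v → Legal G (pos t (mover t)) v × Agree Tracked (moveTo t v) (moveTo t′ v′)
  agree-simulate {Tracked} tracked? {st p mv} {st p′ _} {v′} (refl , same) al′ with tracked? mv
  ... | yes tr = v′ , subst (λ x → Legal G x v′) (sym (same mv tr)) al′ , refl , update-agree
    where
    update-agree : ∀ i → Tracked i → update p mv v′ i ≡ update p′ mv v′ i
    update-agree i tri with i ≟ mv
    ... | yes _ = refl
    ... | no _ = same i tri
  ... | no ¬tr = p mv , inj₁ refl , refl , λ i tri →
      trans (update-idle p mv i) (trans (same i tri) (sym (update-other p′ mv v′ λ { refl → ¬tr tri })))

  ¬¬-∀-State : ∀ {P : State → Set} → (∀ {p p′ mv} → p ≗ p′ → P (st p mv) → P (st p′ mv)) →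
               (∀ t → ¬ ¬ P t) → ¬ ¬ (∀ t → P t)
  ¬¬-∀-State resp h =
    ¬¬-map (λ all t → all (pos t) (mover t))
      (¬¬-∀-Vector (λ e r mv → resp e (r mv)) λ p → ¬¬-∀-Fin λ mv → h (st p mv))

  module StateGame
    (Tracked : Tok → Set) (tracked? : Decidable Tracked)
    (Target : State → Set) (target? : Decidable Target)
    (target-resp : ∀ {t t′} → Agree Tracked t t′ → Target t → Target t′)
    (target-capture : ∀ {t} → Target t → IsCapture t)
    (role : Tok → Player) where

    open ReachabilityGame Target target? (role ∘ mover) (λ t → Legal G (pos t (mover t)))
           (λ t → legal? (pos t (mover t))) moveTo (λ t → pos t (mover t) , inj₁ refl) public
    open Invariance (Agree Tracked) agree-sym target-resp (cong role ∘ proj₁) (agree-simulate tracked?) public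

    ¬¬winning? : ¬ ¬ Decidable Winning
    ¬¬winning? = ¬¬-∀-State (λ e → map′ (winning-resp (pointwise e)) (winning-resp (pointwise (sym ∘ e))))
                            (λ _ → ¬¬-excluded-middle)
      where
      pointwise : ∀ {p p′ mv} → p ≗ p′ → Agree Tracked (st p mv) (st p′ mv)
      pointwise e = refl , λ i _ → e i

    module Strategies (winning? : Decidable Winning) where
      open Optimal winning? public

      optimal : Profile
      optimal = follow play play-allowed

      Follows : Player → Profile → Set
      Follows pl π = ∀ t → role (mover t) ≡ pl → moveOf π t ≡ bestMove pl t

      optimal-follows : ∀ pl → Follows pl optimal
      optimal-follows pl t own = trans (moveOf-follow play play-allowed t) (cong (λ pl → bestMove pl t) own)

      run-step : ∀ {pl π} → Follows pl π → ∀ s i → IsCapture (run π s i) ⊎ Step pl (run π s) i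
      run-step {π = π} fol s i with capture? (run π s i)
      ... | yes c = inj₁ c
      ... | no nc = inj₂ (step (moveOf π t) (proj₂ (π (mover t)) t) (stepS-move π nc) (fol t))
        where t = run π s i

      reacher-captures : ∀ {π} → Follows reacher π → ∀ s k → Attr k s →
                         ∃ λ i → i ≤ k × IsCapture (run π s i)
      reacher-captures {π} fol s k =
        reaches-within (λ i → IsCapture (run π s i)) (run π s) target-capture (run-step fol s) k

      avoider-delays : ∀ {π} → Follows avoider π → ∀ s t → Target (run π s t) → Attr t s
      avoider-delays {π} fol s t = target-at⇒attr (λ i → map₁ (stepS-capture π) (run-step fol s i)) t

  cop≢robber : ∀ m → cop m ≢ robber
  cop≢robber m = fromℕ≢inject₁ ∘ sym

  ForcesCaptureBy : Fin K → State → Set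
  ForcesCaptureBy m s = Σ (Strategy (cop m)) λ f → ∀ σ → LeadsToCopCapture (override σ (cop m) f) s m

  capture-resp : ∀ {t t′} → Agree (λ _ → ⊤) t t′ → IsCapture t → IsCapture t′
  capture-resp (_ , same) (c , e) = c , trans (sym (same (cop c) tt)) (trans e (same robber tt))

  module Cops =
    StateGame (λ _ → ⊤) (λ _ → yes tt) IsCapture capture? capture-resp (λ c → c) (sole robber avoider)

  module CopsStrategies (winning? : Decidable Cops.Winning) where
    open Cops.Strategies winning?

    captureTime≤ : ∀ {π π′} → Follows reacher π → Follows avoider π′ → ∀ s → CaptureTime≤ π π′ s
    captureTime≤ {π} fr fa s t c with reacher-captures fr s t (avoider-delays fa s t c)
    ... | i , i≤t , cᵢ = run-capture-mono π s i≤t cᵢ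

    optimal-CROptimal : CROptimal optimal
    optimal-CROptimal s =
      (λ τ → captureTime≤ (optimal-follows reacher) (robber-follows τ) s) ,
      (λ ρ → captureTime≤ (cops-follow ρ) (optimal-follows avoider) s)
      where
      robber-follows : ∀ τ → Follows avoider (override τ robber (optimal robber))
      robber-follows τ t own =
        trans (moveOf-override-self τ optimal t (sole-self (mover t) own)) (optimal-follows avoider t own)
      cops-follow : ∀ ρ → Follows reacher (override optimal robber ρ)
      cops-follow ρ t own =
        trans (moveOf-override-other optimal ρ t (sole-other (mover t) own)) (optimal-follows reacher t own)

    canCapture⇒forcesCaptureBy : ∀ {k s} → ForcedĈCapture s → CanCaptureWith k s →
                                 ∃ λ m → ForcesCaptureBy m s
    canCapture⇒forcesCaptureBy {s = s} forced (A , _ , robber∉A , σ , wins) with winning? s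
    ... | no ¬w = ⊥-elim (¬w (t , avoider-delays robber-follows s t c))
      where
      robber-follows : Follows avoider (merge A σ optimal)
      robber-follows t own =
        trans (moveOf-merge-outside A σ optimal t
                 (subst (λ i → lookup A i ≡ false) (sym (sole-self (mover t) own)) robber∉A))
              (optimal-follows avoider t own)
      t = proj₁ (wins optimal)
      c = proj₂ (wins optimal)
    ... | yes (k , a) with reacher-captures (optimal-follows reacher) s k a
    ...   | i , _ , m , e = m , optimal (cop m) ,
      forced m (optimal , optimal-CROptimal , i , e)
               (optimal (cop m)) (optimal , optimal-CROptimal , λ _ _ → refl)

  canCapture⇒¬¬forcesCaptureBy : ∀ {k s} → ForcedĈCapture s → CanCaptureWith k s →
                                 ¬ ¬ ∃ λ m → ForcesCaptureBy m s
  canCapture⇒¬¬forcesCaptureBy forced can =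
    ¬¬-map (λ winning? → CopsStrategies.canCapture⇒forcesCaptureBy winning? forced can) Cops.¬¬winning?

  SoloTracked : Fin K → Tok → Set
  SoloTracked m i = i ≡ robber ⊎ i ≡ cop m

  soloCapture-resp : ∀ {m t t′} → Agree (SoloTracked m) t t′ →
                     pos t (cop m) ≡ pos t robber → pos t′ (cop m) ≡ pos t′ robber
  soloCapture-resp (_ , same) e = trans (sym (same _ (inj₂ refl))) (trans e (same robber (inj₁ refl)))

  module Solo (m : Fin K) =
    StateGame (SoloTracked m) (λ i → (i ≟ robber) ⊎-dec (i ≟ cop m))
              (λ t → pos t (cop m) ≡ pos t robber) (λ t → pos t (cop m) ≟ pos t robber)
              soloCapture-resp (m ,_) (sole (cop m) reacher)

  WinsAlone : Fin K → State → Set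
  WinsAlone m = Solo.Winning m

  winsAlone-transfer : ∀ {m t t′} → mover t ≡ mover t′ → pos t robber ≡ pos t′ robber →
                       pos t (cop m) ≡ pos t′ (cop m) → WinsAlone m t → WinsAlone m t′
  winsAlone-transfer {m} same-mover same-robber same-cop =
    Solo.winning-resp m (same-mover , λ { _ (inj₁ refl) → same-robber ; _ (inj₂ refl) → same-cop })

  module SoloStrategies (m : Fin K) (winning? : Decidable (Solo.Winning m)) where
    open Solo.Strategies m winning?

    forcesCaptureBy⇒winsAlone : ∀ {s} → ForcesCaptureBy m s → WinsAlone m s
    forcesCaptureBy⇒winsAlone {s} (f , forced) with forced optimal
    ... | t , e = t , avoider-delays others-follow s t e
      where
      others-follow : Follows avoider (override optimal (cop m) f)
      others-follow t own =
        trans (moveOf-override-other optimal f t (sole-other (mover t) own)) (optimal-follows avoider t own)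

    winsAlone⇒copNum1 : ∀ {s} → WinsAlone m s → StateCopNumIs s 1
    winsAlone⇒copNum1 {s} (k , a) =
      ≤-refl , ≤-trans (s≤s z≤n) (toℕ<n m) ,
      (⁅ cop m ⁆ , ∣⁅x⁆∣≡1 (cop m) , lookup-⁅⁆-other (cop≢robber m ∘ sym) , optimal , captures) ,
      λ { _ (s≤s z≤n) (s≤s ()) }
      where
      m-follows : ∀ τ → Follows reacher (merge ⁅ cop m ⁆ optimal τ)
      m-follows τ t own =
        trans (moveOf-merge-inside ⁅ cop m ⁆ optimal τ t
                 (subst (λ i → lookup ⁅ cop m ⁆ i ≡ true) (sym (sole-self (mover t) own))
                        (lookup-⁅⁆-self (cop m))))
              (optimal-follows reacher t own)
      captures : ∀ τ → LeadsToCapture (merge ⁅ cop m ⁆ optimal τ) s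
      captures τ with reacher-captures (m-follows τ) s k a
      ... | i , _ , c = i , c

  forcesCaptureBy⇒¬¬winsAlone : ∀ {m s} → ForcesCaptureBy m s → ¬ ¬ WinsAlone m s
  forcesCaptureBy⇒¬¬winsAlone {m} F =
    ¬¬-map (λ winning? → SoloStrategies.forcesCaptureBy⇒winsAlone m winning? F) (Solo.¬¬winning? m)

  winsAlone⇒¬¬copNum1 : ∀ {m s} → WinsAlone m s → ¬ ¬ StateCopNumIs s 1
  winsAlone⇒¬¬copNum1 {m} W =
    ¬¬-map (λ winning? → SoloStrategies.winsAlone⇒copNum1 m winning? W) (Solo.¬¬winning? m)

  stepOnto : V G → State → V G
  stepOnto w t = if E (pos t (mover t)) w then w else pos t (mover t)

  stepOnto-legal : ∀ w t → Legal G (pos t (mover t)) (stepOnto w t)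
  stepOnto-legal w t with E (pos t (mover t)) w in adj
  ... | true = inj₂ adj
  ... | false = inj₁ refl

  stepOnto-adjacent : ∀ {w} t → E (pos t (mover t)) w ≡ true → stepOnto w t ≡ w
  stepOnto-adjacent t adj rewrite adj = refl

  forcesCaptureBy-occupies : ∀ {m j s w} → mover s ≡ robber → NonCapture s → E (pos s robber) w ≡ true →
                             pos s (cop j) ≡ w → ForcesCaptureBy m s → pos s (cop m) ≡ w
  forcesCaptureBy-occupies {m} {j} {s} {w} mr nc adj occupied (f , forced) with pos s (cop m) ≟ w
  ... | yes x≡w = x≡w
  ... | no x≢w = ⊥-elim (escapes (forced onto))
    where
    onto = follow (stepOnto w) (stepOnto-legal w)
    P = override onto (cop m) f
    robber-moves : moveOf P s ≡ w
    robber-moves = trans (moveOf-override-other onto f s λ e → cop≢robber m (trans (sym e) mr))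
                   (trans (moveOf-follow (stepOnto w) (stepOnto-legal w) s)
                          (stepOnto-adjacent s (subst (λ i → E (pos s i) w ≡ true) (sym mr) adj)))
    first : run P s 1 ≡ moveTo s w
    first = trans (stepS-move P nc) (cong (moveTo s) robber-moves)
    cops-stay : ∀ k → pos (moveTo s w) (cop k) ≡ pos s (cop k)
    cops-stay k = update-other (pos s) (mover s) w λ e → cop≢robber k (trans e mr)
    robber-on-w : pos (moveTo s w) robber ≡ w
    robber-on-w = update-self (pos s) (mover s) w (sym mr)
    captured : IsCapture (run P s 1)
    captured = subst IsCapture (sym first) (j , trans (cops-stay j) (trans occupied (sym robber-on-w)))
    escapes : ¬ LeadsToCopCapture P s m
    escapes (zero , e) = nc (m , e)
    escapes (suc t , e) = x≢w (trans (sym (cops-stay m)) (trans e₁ robber-on-w))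
      where
      e₁ : pos (moveTo s w) (cop m) ≡ pos (moveTo s w) robber
      e₁ = subst (λ u → pos u (cop m) ≡ pos u robber)
                 (trans (run-frozen P s {j = suc t} (s≤s z≤n) captured) first) e

  placement : V G → Fin K → V G → V G → State
  placement y m a b = st (update (update (λ _ → b) (cop m) a) robber y) robber

  module _ (y : V G) (m : Fin K) (a b : V G) where
    placement-robber : pos (placement y m a b) robber ≡ y
    placement-robber = update-self _ robber y refl

    placement-cop : pos (placement y m a b) (cop m) ≡ a
    placement-cop = trans (update-other _ robber y (cop≢robber m)) (update-self _ (cop m) a refl)

    placement-other : ∀ {j} → j ≢ m → pos (placement y m a b) (cop j) ≡ b
    placement-other {j} j≢m =
      trans (update-other _ robber y (cop≢robber j)) (update-other _ (cop m) a (j≢m ∘ inject₁-injective))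

    placement-nonCapture : a ≢ y → b ≢ y → NonCapture (placement y m a b)
    placement-nonCapture a≢y b≢y (j , e) with j ≟ m
    ... | yes refl = a≢y (trans (sym placement-cop) (trans e placement-robber))
    ... | no j≢m = b≢y (trans (sym (placement-other j≢m)) (trans e placement-robber))

  ¬¬copNum : ∀ {k s} → 1 ≤ k → k ≤ K → CanCaptureWith k s → ¬ ¬ ∃ λ j → StateCopNumIs s j
  ¬¬copNum {k} {s} 1≤k k≤K can = ¬¬-map
    (λ (j , (1≤j , can′) , min) → j , 1≤j , ≤-trans (minimal≤ min (1≤k , can)) k≤K , can′ ,
                                  λ i 1≤i i<j can″ → min i<j (1≤i , can″))
    (¬¬-least {λ j → 1 ≤ j × CanCaptureWith j s} {k} (1≤k , can))

  module Crowding (forced : ∀ s → NonCapture s → StateCopNumIs s 1 → ForcedĈCapture s)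
                  (another : ∀ (m : Fin K) → ∃ λ j → j ≢ m) where

    Covers : Fin K → State → Set
    Covers m t = ∀ j {z} → E (pos t robber) z ≡ true → pos t (cop j) ≡ z → pos t (cop m) ≡ z

    copNum1-capturer : ∀ {t} → mover t ≡ robber → NonCapture t → StateCopNumIs t 1 →
                       ¬ ¬ ∃ λ m → WinsAlone m t × Covers m t
    copNum1-capturer mr nc c1 ¬capturer =
      canCapture⇒¬¬forcesCaptureBy (forced _ nc c1) (proj₁ (proj₂ (proj₂ c1))) λ (m , F) →
      forcesCaptureBy⇒¬¬winsAlone F λ W →
      ¬capturer (m , W , λ _ adj occupied → forcesCaptureBy-occupies mr nc adj occupied F)

    placement-capturer : ∀ {y m a b} → a ≢ y → b ≢ y → WinsAlone m (placement y m a b) →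
                         ¬ ¬ ∃ λ m′ → WinsAlone m′ (placement y m a b) × Covers m′ (placement y m a b)
    placement-capturer {y} {m} {a} {b} a≢y b≢y W ¬capturer =
      winsAlone⇒¬¬copNum1 W λ c1 →
      copNum1-capturer refl (placement-nonCapture y m a b a≢y b≢y) c1 ¬capturer

    robber-neighbour-unique : ∀ {s w₁ w₂} → mover s ≡ robber → NonCapture s → StateCopNumIs s 1 →
                              E (pos s robber) w₁ ≡ true → E (pos s robber) w₂ ≡ true → w₁ ≡ w₂
    robber-neighbour-unique {s} {w₁} {w₂} mr nc c1 adj₁ adj₂ =
      decidable-stable (w₁ ≟ w₂) λ w₁≢w₂ → copNum1-capturer mr nc c1 λ (m , W , _) →
        case pos s (cop m) ≟ w₁ of λ
          { (yes x≡w₁) → crowd W (λ x≡w₂ → w₁≢w₂ (trans (sym x≡w₁) x≡w₂)) w₁≢w₂ adj₂ adj₁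
          ; (no x≢w₁) → crowd W x≢w₁ (w₁≢w₂ ∘ sym) adj₁ adj₂ }
      where
      y = pos s robber
      at : ∀ {z m a b} → E y z ≡ true → E (pos (placement y m a b) robber) z ≡ true
      at {z} {m} {a} {b} = subst (λ r → E r z ≡ true) (sym (placement-robber y m a b))
      crowd : ∀ {m w w′} → WinsAlone m s → pos s (cop m) ≢ w → w′ ≢ w → E y w ≡ true → E y w′ ≡ true → ⊥
      crowd {m} {w} {w′} W x≢w w′≢w adj adj′ =
        placement-capturer (λ e → nc (m , e)) (adjacent-≢ adj) W₁ λ (m₁ , W₁′ , covers₁) →
        placement-capturer (adjacent-≢ adj) (adjacent-≢ adj′)
          (W₂ (covers₁ (other m) (at adj) (others-on m x w)) W₁′) λ (_ , _ , covers₂) →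
        w′≢w (trans (sym (covers₂ (other m₁) (at adj′) (others-on m₁ w w′)))
                    (covers₂ m₁ (at adj) (placement-cop y m₁ w w′)))
        where
        x = pos s (cop m)
        other : Fin K → Fin K
        other = proj₁ ∘ another
        others-on : ∀ m a b → pos (placement y m a b) (cop (other m)) ≡ b
        others-on m a b = placement-other y m a b (proj₂ (another m))
        W₁ : WinsAlone m (placement y m x w)
        W₁ = winsAlone-transfer mr (sym (placement-robber y m x w)) (sym (placement-cop y m x w)) W
        W₂ : ∀ {m₁} → pos (placement y m x w) (cop m₁) ≡ w → WinsAlone m₁ (placement y m x w) →
             WinsAlone m₁ (placement y m₁ w w′)
        W₂ {m₁} on-w = winsAlone-transfer refl
          (trans (placement-robber y m x w) (sym (placement-robber y m₁ w w′)))
          (trans on-w (sym (placement-cop y m₁ w w′)))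

∃-≢ : ∀ {k} (m : Fin (suc (suc k))) → ∃ λ j → j ≢ m
∃-≢ zero = suc zero , λ ()
∃-≢ (suc _) = zero , λ ()

lemma20 : (K : ℕ) → 2 ≤ K → (G : Graph) → Game.InG3 G K →
          (s : Game.State G K) → Game.mover s ≡ Game.robber G K →
          Game.NonCapture G K s → Game.StateCopNumIs G K s 1 →
          Game.ForcedĈCapture G K s →
          (∣ Nbhd G (Game.pos s (Game.robber G K)) ∣ ≡ 1) ×
          (∀ v → Nbhd G (Game.pos s (Game.robber G K)) ≡ ⁅ v ⁆ →
            ∀ (s′ : Game.State G K) → Game.mover s′ ≡ Game.robber G K →
            Game.pos s′ (Game.robber G K) ≡ v → Game.NonCapture G K s′ →
            Game.StateCopNumInf G K s′)
lemma20 (suc (suc K′)) (s≤s (s≤s _)) G (((inG , ¬G1) , _) , forced) s mr nc c1 _ = leaf , beyond-leaf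
  where
  open Graph G
  open Game G (suc (suc K′))
  open GraphProperties G
  open GameProperties G (suc (suc K′))
  open Crowding forced ∃-≢
  y = pos s robber
  leaf : ∣ Nbhd G y ∣ ≡ 1
  leaf with has-neighbour (λ e → nc (zero , sym e))
  ... | w , adj =
    trans (cong ∣_∣ (Nbhd≡⁅⁆ adj λ adj′ → robber-neighbour-unique mr nc c1 adj′ adj)) (∣⁅x⁆∣≡1 w)
  beyond-leaf : ∀ v → Nbhd G y ≡ ⁅ v ⁆ → ∀ s′ → mover s′ ≡ robber → pos s′ robber ≡ v →
                NonCapture s′ → StateCopNumInf s′
  beyond-leaf v N≡v s′ mr′ at-v nc′ k 1≤k k≤K can = ¬¬copNum 1≤k k≤K can λ
    { (zero , () , _)
    ; (suc zero , c1′) → inG 1 (s≤s z≤n) (edge-copWin y-v (proj₂ (Nbhd≡⁅⁆⁻ N≡v))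
        λ adj → robber-neighbour-unique mr′ nc′ c1′ (from-v adj) (from-v (trans (E-sym v y) y-v)))
    ; (suc (suc j) , c) → ¬G1 (s′ , nc′ , suc (suc j) , s≤s (s≤s z≤n) , proj₁ (proj₂ c) , c) }
    where
    y-v = proj₁ (Nbhd≡⁅⁆⁻ N≡v)
    from-v : ∀ {z} → E v z ≡ true → E (pos s′ robber) z ≡ true
    from-v {z} = subst (λ r → E r z ≡ true) (sym at-v)
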